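{- Let $n\ge 1$, let $G_n\in HL_n$, and let $i$ be an integer with $1\le i<2^n$, written in binary as $i=2^{t_0}+2^{t_1}+\dots+2^{t_s}$ with $t_0>t_1>\dots>t_s\ge 0$. Then $e_{i+1}=e_i+s+1$, where $e_g$ denotes the maximum number of edges of a subgraph of $G_n$ induced by $g$ vertices.
   Context: HL-networks are defined recursively: $HL_0=\{K_1\}$ and $HL_n=\{G_{n-1}\oplus G^*_{n-1} : G_{n-1},G^*_{n-1}\in HL_{n-1}\}$, where $G_{n-1}\oplus G^*_{n-1}$ denotes any graph obtained from the disjoint union of $G_{n-1}$ and $G^*_{n-1}$ by adding a perfect matching between their vertex sets. Each $G_n\in HL_n$ is $n$-regular with $2^n$ vertices. -}

module Defs where

open import Data.Nat using (ℕ; zero; suc; _+_; _⊔_; _<ᵇ_)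
open import Data.Nat.Properties using (_≟_)
open import Data.Bool using (Bool; true; false; _∧_; if_then_else_)
open import Data.Fin using (Fin; toℕ; splitAt)
open import Data.Fin.Properties using () renaming (_≟_ to _≟ᶠ_)
open import Data.Fin.Subset using (Subset; inside; outside; ∣_∣; _∈_)
open import Data.Fin.Subset.Properties using (_∈?_)
open import Data.Fin.Permutation using (Permutation′; _⟨$⟩ʳ_)
open import Data.List using (List; []; _∷_; _++_; map; filter; foldr; allFin; concatMap)
open import Data.Nat.ListAction using (sum)
open import Data.Vec using (_∷_; [])
open import Data.Sum using (inj₁; inj₂)
open import Relation.Nullary.Decidable using (⌊_⌋)

record Graph (m : ℕ) : Set where
  field adj : Fin m → Fin m → Bool
open Graph public

-- Number of vertices of a member of HL_n (equal to 2^n);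
-- defined so that size (suc n) = size n + size n definitionally.
size : ℕ → ℕ
size zero = 1
size (suc n) = size n + size n

K₁ : Graph 1
adj K₁ _ _ = false

-- G ⊕_π G* : disjoint union of G (vertices Fin k, embedded as the first
-- block of Fin (k + k)) and G* (second block), plus the perfect matching
-- joining vertex a of G to vertex π(a) of G*, for a bijection π.
⊕ : ∀ {k} → Graph k → Graph k → Permutation′ k → Graph (k + k)
adj (⊕ {k} G H π) x y with splitAt k x | splitAt k y
... | inj₁ a | inj₁ b = adj G a b
... | inj₂ a | inj₂ b = adj H a b
... | inj₁ a | inj₂ b = ⌊ (π ⟨$⟩ʳ a) ≟ᶠ b ⌋
... | inj₂ a | inj₁ b = ⌊ (π ⟨$⟩ʳ b) ≟ᶠ a ⌋

data HL : (n : ℕ) → Graph (size n) → Set where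
  hl₀ : HL zero K₁
  hl₊ : ∀ {n G H} → HL n G → HL n H → (π : Permutation′ (size n)) →
        HL (suc n) (⊕ G H π)

allSubsets : (m : ℕ) → List (Subset m)
allSubsets zero = [] ∷ []
allSubsets (suc m) = map (inside ∷_) (allSubsets m) ++ map (outside ∷_) (allSubsets m)

inducedEdges : ∀ {m} → Graph m → Subset m → ℕ
inducedEdges {m} G S =
  sum (concatMap (λ u → map (λ v →
         if ((toℕ u <ᵇ toℕ v) ∧ ⌊ u ∈? S ⌋ ∧ ⌊ v ∈? S ⌋ ∧ adj G u v) then 1 else 0)
       (allFin m)) (allFin m))

-- e_g : maximum number of edges of a subgraph of G induced by g vertices
-- (0 if there is no g-element vertex set).
maxEdges : ∀ {m} → Graph m → ℕ → ℕ
maxEdges {m} G g =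
  foldr _⊔_ 0 (map (inducedEdges G) (filter (λ S → ∣ S ∣ ≟ g) (allSubsets m)))

-- Write h g = Σ_{j<g} popcount j (onesBelow below).  For G ∈ HL_n and g ≤ 2^n
-- we show e_g = h g, so e_{i+1} − e_i = popcount i, the number of ones in the
-- binary expansion of i, i.e. s + 1.  Upper bound, by induction on n: a g-set
-- of G ⊕ G* meets G in a vertices and G* in b, the matching contributes at most
-- min(a, b) edges, and h a + h b + min(a, b) ≤ h (a + b), proved by strong
-- induction on a + b from h (2x) = 2 h x + x and h (2x + 1) = h x + h (x + 1) + x.
-- Lower bound: a g-set of G if g ≤ 2^(n−1); otherwise all of G together with an
-- r-set of G* (g = 2^(n−1) + r), all of whose matching edges are present, and
-- h (2^t + r) = h (2^t) + h r + r.
module Submission where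

open import Defs
open import Data.Nat using (ℕ; suc; _+_; _^_; _≤_; _<_; _>_)
open import Data.List using (List; length; map)
open import Data.Nat.ListAction using (sum)
open import Data.List.Relation.Unary.Linked using (Linked)
open import Relation.Binary.PropositionalEquality using (_≡_)

open import Data.Nat using (zero; _*_; _⊓_; _⊔_; _<ᵇ_; z≤n; s≤s; z<s)
open import Data.Nat.Properties
open import Data.Nat.Induction using (<-rec)
open import Data.Nat.Tactic.RingSolver using (solve-∀)
open import Data.Nat.ListAction.Properties using (sum-++)
open import Data.Bool using (Bool; true; false; _∧_; if_then_else_)
open import Data.Bool.Properties using (∧-assoc; ∧-zeroʳ; ∧-identityʳ)
open import Data.Sum using (inj₁; inj₂)
open import Data.Product using (∃-syntax; _×_; _,_)
open import Data.Fin using (Fin; zero; suc; toℕ; _↑ˡ_; _↑ʳ_)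
open import Data.Fin.Properties using (toℕ-↑ˡ; toℕ-↑ʳ; splitAt-↑ˡ; splitAt-↑ʳ; toℕ<n) renaming (_≟_ to _≟ᶠ_)
open import Data.Fin.Subset using (Subset; inside; outside; ∣_∣; ⊤; ⊥)
open import Data.Fin.Subset.Properties using (_∈?_; ∣⊤∣≡n; ∣⊥∣≡0; ∣p∣≡n⇒p≡⊤)
open import Data.Fin.Permutation using (Permutation′; _⟨$⟩ʳ_)
open import Data.Vec using ([]; _∷_; _++_; lookup; splitAt)
open import Data.Vec.Properties using (lookup-++ˡ; lookup-++ʳ; lookup-replicate)
open import Data.List using ([]; _∷_; concatMap; allFin; tabulate; foldr)
open import Data.List.Properties using (map-tabulate; map-cong)
open import Data.List.Relation.Unary.Linked as Linked using ([]; _∷_)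
open import Data.List.Relation.Unary.All as All using (All; []; _∷_)
open import Data.List.Relation.Unary.All.Properties using (all-filter; map⁺)
open import Data.List.Relation.Unary.Any using (here; there)
open import Data.List.Membership.Propositional using (_∈_)
open import Data.List.Membership.Propositional.Properties using (∈-filter⁺; ∈-++⁺ˡ; ∈-++⁺ʳ; ∈-map⁺)
open import Algebra.Properties.CommutativeMonoid.Sum +-0-commutativeMonoid
  using (sum-syntax; sum-cong-≗; ∑-distrib-+; ∑-permute; sum-replicate-zero)
  renaming (sum to ∑)
open import Function using (_∘_)
open import Relation.Binary.PropositionalEquality using (refl; sym; trans; cong; cong₂; subst; subst₂; module ≡-Reasoning)
open import Relation.Nullary.Decidable using (⌊_⌋; ⌊⌋-map′)

-- Binary digit sums

-- b ·0 and b ·1 stand for 2b and 2b + 1.  The numerals produced by bits have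
-- no leading zero and double preserves this, so bits (2 * x) ≡ double (bits x).
infixl 8 _·0 _·1

data Bits : Set where
  ε       : Bits
  _·0 _·1 : Bits → Bits

inc : Bits → Bits
inc ε      = ε ·1
inc (b ·0) = b ·1
inc (b ·1) = inc b ·0

bits : ℕ → Bits
bits zero    = ε
bits (suc n) = inc (bits n)

ones : Bits → ℕ
ones ε      = 0
ones (b ·0) = ones b
ones (b ·1) = suc (ones b)

popcount : ℕ → ℕ
popcount = ones ∘ bits

double : Bits → Bits
double ε      = ε
double (b ·0) = b ·0 ·0
double (b ·1) = b ·1 ·0

inc-inc-double : ∀ b → inc (inc (double b)) ≡ double (inc b)
inc-inc-double ε      = refl
inc-inc-double (b ·0) = refl
inc-inc-double (b ·1) = refl

bits-double : ∀ x → bits (2 * x) ≡ double (bits x)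
bits-double zero    = refl
bits-double (suc x) = begin
  bits (2 * suc x)             ≡⟨ cong bits (*-suc 2 x) ⟩
  inc (inc (bits (2 * x)))     ≡⟨ cong (inc ∘ inc) (bits-double x) ⟩
  inc (inc (double (bits x)))  ≡⟨ inc-inc-double (bits x) ⟩
  double (bits (suc x))        ∎
  where open ≡-Reasoning

ones-double : ∀ b → ones (double b) ≡ ones b
ones-double ε      = refl
ones-double (b ·0) = refl
ones-double (b ·1) = refl

ones-inc-double : ∀ b → ones (inc (double b)) ≡ suc (ones b)
ones-inc-double ε      = refl
ones-inc-double (b ·0) = refl
ones-inc-double (b ·1) = refl

popcount-double : ∀ x → popcount (2 * x) ≡ popcount x
popcount-double x = trans (cong ones (bits-double x)) (ones-double (bits x))

popcount-suc-double : ∀ x → popcount (suc (2 * x)) ≡ suc (popcount x)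
popcount-suc-double x = trans (cong (ones ∘ inc) (bits-double x)) (ones-inc-double (bits x))

data EvenOdd : ℕ → Set where
  even : ∀ x → EvenOdd (2 * x)
  odd  : ∀ x → EvenOdd (suc (2 * x))

evenOdd : ∀ n → EvenOdd n
evenOdd zero = even 0
evenOdd (suc n) with evenOdd n
... | even x = odd x
... | odd x  = subst EvenOdd (*-suc 2 x) (even (suc x))

onesBelow : ℕ → ℕ
onesBelow zero    = 0
onesBelow (suc g) = onesBelow g + popcount g

onesBelow-double : ∀ x → onesBelow (2 * x) ≡ 2 * onesBelow x + x
onesBelow-double zero    = refl
onesBelow-double (suc x) = begin
  onesBelow (2 * suc x)
    ≡⟨ cong onesBelow (*-suc 2 x) ⟩
  onesBelow (2 * x) + popcount (2 * x) + popcount (suc (2 * x))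
    ≡⟨ cong₂ _+_ (cong₂ _+_ (onesBelow-double x) (popcount-double x)) (popcount-suc-double x) ⟩
  2 * onesBelow x + x + popcount x + suc (popcount x)
    ≡⟨ regroup (onesBelow x) (popcount x) x ⟩
  2 * (onesBelow x + popcount x) + suc x ∎
  where
  open ≡-Reasoning
  regroup : ∀ h p x → 2 * h + x + p + suc p ≡ 2 * (h + p) + suc x
  regroup = solve-∀

onesBelow-suc-double : ∀ x → onesBelow (suc (2 * x)) ≡ onesBelow x + onesBelow (suc x) + x
onesBelow-suc-double x = begin
  onesBelow (2 * x) + popcount (2 * x)  ≡⟨ cong₂ _+_ (onesBelow-double x) (popcount-double x) ⟩
  2 * onesBelow x + x + popcount x      ≡⟨ regroup (onesBelow x) (popcount x) x ⟩
  onesBelow x + onesBelow (suc x) + x   ∎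
  where
  open ≡-Reasoning
  regroup : ∀ h p x → 2 * h + x + p ≡ h + (h + p) + x
  regroup = solve-∀

popcount-2^+ : ∀ t r → r < 2 ^ t → popcount (2 ^ t + r) ≡ suc (popcount r)
popcount-2^+ zero    zero    _         = refl
popcount-2^+ zero    (suc r) (s≤s ())
popcount-2^+ (suc t) r r<2^t+1 with evenOdd r
... | even x = begin
  popcount (2 * 2 ^ t + 2 * x)  ≡⟨ cong popcount (sym (*-distribˡ-+ 2 (2 ^ t) x)) ⟩
  popcount (2 * (2 ^ t + x))    ≡⟨ popcount-double (2 ^ t + x) ⟩
  popcount (2 ^ t + x)          ≡⟨ popcount-2^+ t x (*-cancelˡ-< 2 x (2 ^ t) r<2^t+1) ⟩
  suc (popcount x)              ≡⟨ cong suc (popcount-double x) ⟨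
  suc (popcount (2 * x))        ∎
  where open ≡-Reasoning
... | odd x = begin
  popcount (2 * 2 ^ t + suc (2 * x))  ≡⟨ cong popcount (+-suc (2 * 2 ^ t) (2 * x)) ⟩
  popcount (suc (2 * 2 ^ t + 2 * x))  ≡⟨ cong (popcount ∘ suc) (sym (*-distribˡ-+ 2 (2 ^ t) x)) ⟩
  popcount (suc (2 * (2 ^ t + x)))    ≡⟨ popcount-suc-double (2 ^ t + x) ⟩
  suc (popcount (2 ^ t + x))          ≡⟨ cong suc (popcount-2^+ t x (*-cancelˡ-< 2 x (2 ^ t) (<-trans (n<1+n _) r<2^t+1))) ⟩
  suc (suc (popcount x))              ≡⟨ cong suc (popcount-suc-double x) ⟨
  suc (popcount (suc (2 * x)))        ∎
  where open ≡-Reasoning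

onesBelow-2^+ : ∀ t r → r ≤ 2 ^ t → onesBelow (2 ^ t + r) ≡ onesBelow (2 ^ t) + onesBelow r + r
onesBelow-2^+ t zero    _ = begin
  onesBelow (2 ^ t + 0)             ≡⟨ cong onesBelow (+-identityʳ (2 ^ t)) ⟩
  onesBelow (2 ^ t)                 ≡⟨ +-identityʳ _ ⟨
  onesBelow (2 ^ t) + 0             ≡⟨ +-identityʳ _ ⟨
  onesBelow (2 ^ t) + 0 + 0         ∎
  where open ≡-Reasoning
onesBelow-2^+ t (suc r) r<2^t = begin
  onesBelow (2 ^ t + suc r)
    ≡⟨ cong onesBelow (+-suc (2 ^ t) r) ⟩
  onesBelow (2 ^ t + r) + popcount (2 ^ t + r)
    ≡⟨ cong₂ _+_ (onesBelow-2^+ t r (<⇒≤ r<2^t)) (popcount-2^+ t r r<2^t) ⟩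
  onesBelow (2 ^ t) + onesBelow r + r + suc (popcount r)
    ≡⟨ regroup (onesBelow (2 ^ t)) (onesBelow r) (popcount r) r ⟩
  onesBelow (2 ^ t) + (onesBelow r + popcount r) + suc r ∎
  where
  open ≡-Reasoning
  regroup : ∀ a h p r → a + h + r + suc p ≡ a + (h + p) + suc r
  regroup = solve-∀

sum-2^<2^ : ∀ {t ts} → Linked _>_ (t ∷ ts) → sum (map (2 ^_) ts) < 2 ^ t
sum-2^<2^ {t} {[]}     _           = m^n>0 2 t
sum-2^<2^ {t} {u ∷ us} (t>u ∷ us↓) = begin-strict
  2 ^ u + sum (map (2 ^_) us)  <⟨ +-monoʳ-< (2 ^ u) (sum-2^<2^ us↓) ⟩
  2 ^ u + 2 ^ u                ≡⟨ cong (2 ^ u +_) (+-identityʳ (2 ^ u)) ⟨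
  2 ^ suc u                    ≤⟨ ^-monoʳ-≤ 2 t>u ⟩
  2 ^ t                        ∎
  where open ≤-Reasoning

popcount-sum-2^ : ∀ {ts} → Linked _>_ ts → popcount (sum (map (2 ^_) ts)) ≡ length ts
popcount-sum-2^ {[]}     _  = refl
popcount-sum-2^ {t ∷ ts} ts↓ =
  trans (popcount-2^+ t _ (sum-2^<2^ ts↓)) (cong suc (popcount-sum-2^ (Linked.tail ts↓)))

-- Superadditivity of onesBelow

Superadditive : ℕ → ℕ → Set
Superadditive a b = onesBelow a + onesBelow b + a ⊓ b ≤ onesBelow (a + b)

superadditive-comm : ∀ a b → Superadditive a b → Superadditive b a
superadditive-comm a b sa = begin
  onesBelow b + onesBelow a + b ⊓ a  ≡⟨ cong₂ _+_ (+-comm (onesBelow b) (onesBelow a)) (⊓-comm b a) ⟩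
  onesBelow a + onesBelow b + a ⊓ b  ≤⟨ sa ⟩
  onesBelow (a + b)                  ≡⟨ cong onesBelow (+-comm a b) ⟩
  onesBelow (b + a)                  ∎
  where open ≤-Reasoning

superadditive-zeroˡ : ∀ b → Superadditive 0 b
superadditive-zeroˡ b = ≤-reflexive (+-identityʳ (onesBelow b))

superadditive-double : ∀ x y → Superadditive x y → Superadditive (2 * x) (2 * y)
superadditive-double x y sa = begin
  onesBelow (2 * x) + onesBelow (2 * y) + (2 * x) ⊓ (2 * y)
    ≡⟨ cong₂ _+_ (cong₂ _+_ (onesBelow-double x) (onesBelow-double y)) (sym (*-distribˡ-⊓ 2 x y)) ⟩
  2 * onesBelow x + x + (2 * onesBelow y + y) + 2 * (x ⊓ y)
    ≡⟨ regroup (onesBelow x) (onesBelow y) (x ⊓ y) x y ⟩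
  2 * (onesBelow x + onesBelow y + x ⊓ y) + (x + y)
    ≤⟨ +-monoˡ-≤ (x + y) (*-monoʳ-≤ 2 sa) ⟩
  2 * onesBelow (x + y) + (x + y)
    ≡⟨ onesBelow-double (x + y) ⟨
  onesBelow (2 * (x + y))
    ≡⟨ cong onesBelow (*-distribˡ-+ 2 x y) ⟩
  onesBelow (2 * x + 2 * y) ∎
  where
  open ≤-Reasoning
  regroup : ∀ h k m x y → 2 * h + x + (2 * k + y) + 2 * m ≡ 2 * (h + k + m) + (x + y)
  regroup = solve-∀

⊓-odd-even : ∀ x y → suc (2 * x) ⊓ (2 * y) ≤ x ⊓ y + suc x ⊓ y
⊓-odd-even x y with ≤-<-connex y x
... | inj₁ y≤x = begin
  suc (2 * x) ⊓ (2 * y)  ≤⟨ m⊓n≤n (suc (2 * x)) (2 * y) ⟩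
  2 * y                  ≡⟨ cong (y +_) (+-identityʳ y) ⟩
  y + y                  ≡⟨ cong₂ _+_ (m≥n⇒m⊓n≡n y≤x) (m≥n⇒m⊓n≡n (m≤n⇒m≤1+n y≤x)) ⟨
  x ⊓ y + suc x ⊓ y      ∎
  where open ≤-Reasoning
... | inj₂ x<y = begin
  suc (2 * x) ⊓ (2 * y)  ≤⟨ m⊓n≤m (suc (2 * x)) (2 * y) ⟩
  suc (2 * x)            ≡⟨ cong suc (cong (x +_) (+-identityʳ x)) ⟩
  suc (x + x)            ≡⟨ +-suc x x ⟨
  x + suc x              ≡⟨ cong₂ _+_ (m≤n⇒m⊓n≡m (<⇒≤ x<y)) (m≤n⇒m⊓n≡m x<y) ⟨
  x ⊓ y + suc x ⊓ y      ∎
  where open ≤-Reasoning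

⊓-odd-odd : ∀ x y → suc (2 * x) ⊓ suc (2 * y) ≤ suc (x ⊓ suc y + suc x ⊓ y)
⊓-odd-odd x y with ≤-total x y
... | inj₁ x≤y = begin
  suc (2 * x) ⊓ suc (2 * y)    ≤⟨ m⊓n≤m (suc (2 * x)) (suc (2 * y)) ⟩
  suc (2 * x)                  ≡⟨ cong suc (cong (x +_) (+-identityʳ x)) ⟩
  suc (x + x)                  ≤⟨ s≤s (+-mono-≤ (⊓-glb ≤-refl (m≤n⇒m≤1+n x≤y)) (⊓-glb (n≤1+n x) x≤y)) ⟩
  suc (x ⊓ suc y + suc x ⊓ y)  ∎
  where open ≤-Reasoning
... | inj₂ y≤x = begin
  suc (2 * x) ⊓ suc (2 * y)    ≤⟨ m⊓n≤n (suc (2 * x)) (suc (2 * y)) ⟩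
  suc (2 * y)                  ≡⟨ cong suc (cong (y +_) (+-identityʳ y)) ⟩
  suc (y + y)                  ≤⟨ s≤s (+-mono-≤ (⊓-glb y≤x (n≤1+n y)) (⊓-glb (m≤n⇒m≤1+n y≤x) ≤-refl)) ⟩
  suc (x ⊓ suc y + suc x ⊓ y)  ∎
  where open ≤-Reasoning

superadditive-odd-even : ∀ x y → Superadditive x y → Superadditive (suc x) y →
                         Superadditive (suc (2 * x)) (2 * y)
superadditive-odd-even x y sa sa′ = begin
  onesBelow (suc (2 * x)) + onesBelow (2 * y) + suc (2 * x) ⊓ (2 * y)
    ≤⟨ +-mono-≤ (≤-reflexive (cong₂ _+_ (onesBelow-suc-double x) (onesBelow-double y))) (⊓-odd-even x y) ⟩
  onesBelow x + onesBelow (suc x) + x + (2 * onesBelow y + y) + (x ⊓ y + suc x ⊓ y)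
    ≡⟨ regroup (onesBelow x) (onesBelow (suc x)) (onesBelow y) (x ⊓ y) (suc x ⊓ y) x y ⟩
  (onesBelow x + onesBelow y + x ⊓ y) + (onesBelow (suc x) + onesBelow y + suc x ⊓ y) + (x + y)
    ≤⟨ +-monoˡ-≤ (x + y) (+-mono-≤ sa sa′) ⟩
  onesBelow (x + y) + onesBelow (suc (x + y)) + (x + y)
    ≡⟨ onesBelow-suc-double (x + y) ⟨
  onesBelow (suc (2 * (x + y)))
    ≡⟨ cong (onesBelow ∘ suc) (*-distribˡ-+ 2 x y) ⟩
  onesBelow (suc (2 * x) + 2 * y) ∎
  where
  open ≤-Reasoning
  regroup : ∀ h h′ k m m′ x y → h + h′ + x + (2 * k + y) + (m + m′) ≡ (h + k + m) + (h′ + k + m′) + (x + y)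
  regroup = solve-∀

superadditive-odd-odd : ∀ x y → Superadditive x (suc y) → Superadditive (suc x) y →
                        Superadditive (suc (2 * x)) (suc (2 * y))
superadditive-odd-odd x y sa sa′ = begin
  onesBelow (suc (2 * x)) + onesBelow (suc (2 * y)) + suc (2 * x) ⊓ suc (2 * y)
    ≤⟨ +-mono-≤ (≤-reflexive (cong₂ _+_ (onesBelow-suc-double x) (onesBelow-suc-double y))) (⊓-odd-odd x y) ⟩
  onesBelow x + onesBelow (suc x) + x + (onesBelow y + onesBelow (suc y) + y) + suc (x ⊓ suc y + suc x ⊓ y)
    ≡⟨ regroup (onesBelow x) (onesBelow (suc x)) (onesBelow y) (onesBelow (suc y)) (x ⊓ suc y) (suc x ⊓ y) x y ⟩
  (onesBelow x + onesBelow (suc y) + x ⊓ suc y) + (onesBelow (suc x) + onesBelow y + suc x ⊓ y) + suc (x + y)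
    ≤⟨ +-monoˡ-≤ (suc (x + y)) (+-mono-≤ sa sa′) ⟩
  onesBelow (x + suc y) + onesBelow (suc (x + y)) + suc (x + y)
    ≡⟨ cong (λ z → onesBelow z + onesBelow (suc (x + y)) + suc (x + y)) (+-suc x y) ⟩
  onesBelow (suc (x + y)) + onesBelow (suc (x + y)) + suc (x + y)
    ≡⟨ cong (_+ suc (x + y)) (cong (onesBelow (suc (x + y)) +_) (+-identityʳ _)) ⟨
  2 * onesBelow (suc (x + y)) + suc (x + y)
    ≡⟨ onesBelow-double (suc (x + y)) ⟨
  onesBelow (2 * suc (x + y))
    ≡⟨ cong onesBelow (double-suc-+ x y) ⟩
  onesBelow (suc (2 * x) + suc (2 * y)) ∎
  where
  open ≤-Reasoning
  regroup : ∀ h h′ k k′ m m′ x y →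
            h + h′ + x + (k + k′ + y) + suc (m + m′) ≡ (h + k′ + m) + (h′ + k + m′) + suc (x + y)
  regroup = solve-∀
  double-suc-+ : ∀ x y → 2 * suc (x + y) ≡ suc (2 * x) + suc (2 * y)
  double-suc-+ = solve-∀

m+n≡o⇒m<o : ∀ {m n o} → m + n ≡ o → 0 < n → m < o
m+n≡o⇒m<o {m} m+n≡o 0<n = subst (m <_) m+n≡o (m<m+n m 0<n)

superadditive-step : ∀ a b → (∀ m n → m + n < a + b → Superadditive m n) → Superadditive a b
superadditive-step a b ih with evenOdd a | evenOdd b
... | even zero    | _            = superadditive-zeroˡ b
... | _            | even zero    = superadditive-comm 0 a (superadditive-zeroˡ a)
... | even (suc x) | even (suc y) =
  superadditive-double (suc x) (suc y) (ih (suc x) (suc y) (m+n≡o⇒m<o (halves x y) z<s))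
  where
  halves : ∀ x y → (suc x + suc y) + (suc x + suc y) ≡ 2 * suc x + 2 * suc y
  halves = solve-∀
... | even (suc x) | odd y        =
  superadditive-comm (suc (2 * y)) (2 * suc x)
    (superadditive-odd-even y (suc x) (ih y (suc x) (m+n≡o⇒m<o (split₁ x y) z<s))
                                      (ih (suc y) (suc x) (m+n≡o⇒m<o (split₂ x y) z<s)))
  where
  split₁ : ∀ x y → (y + suc x) + (suc y + suc x) ≡ 2 * suc x + suc (2 * y)
  split₁ = solve-∀
  split₂ : ∀ x y → (suc y + suc x) + (suc x + y) ≡ 2 * suc x + suc (2 * y)
  split₂ = solve-∀
... | odd x        | even (suc y) =
  superadditive-odd-even x (suc y) (ih x (suc y) (m+n≡o⇒m<o (split₁ x y) z<s))
                                   (ih (suc x) (suc y) (m+n≡o⇒m<o (split₂ x y) z<s))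
  where
  split₁ : ∀ x y → (x + suc y) + (suc x + suc y) ≡ suc (2 * x) + 2 * suc y
  split₁ = solve-∀
  split₂ : ∀ x y → (suc x + suc y) + (suc x + y) ≡ suc (2 * x) + 2 * suc y
  split₂ = solve-∀
... | odd x        | odd y        =
  superadditive-odd-odd x y (ih x (suc y) (m+n≡o⇒m<o (split₁ x y) z<s))
                            (ih (suc x) y (m+n≡o⇒m<o (split₂ x y) z<s))
  where
  split₁ : ∀ x y → (x + suc y) + (suc x + y) ≡ suc (2 * x) + suc (2 * y)
  split₁ = solve-∀
  split₂ : ∀ x y → (suc x + y) + (suc x + y) ≡ suc (2 * x) + suc (2 * y)
  split₂ = solve-∀

superadditive : ∀ a b → Superadditive a b
superadditive a b = <-rec P step (a + b) a b refl
  where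
  P : ℕ → Set
  P s = ∀ a b → a + b ≡ s → Superadditive a b
  step : ∀ s → (∀ {s′} → s′ < s → P s′) → P s
  step _ ih a b refl = superadditive-step a b (λ m n lt → ih lt m n refl)


-- Sums over Fin and induced edge counts

𝟙 : Bool → ℕ
𝟙 b = if b then 1 else 0

∑-mono-≤ : ∀ {n} {f g : Fin n → ℕ} → (∀ i → f i ≤ g i) → ∑ f ≤ ∑ g
∑-mono-≤ {zero}  _   = z≤n
∑-mono-≤ {suc n} f≤g = +-mono-≤ (f≤g zero) (∑-mono-≤ (f≤g ∘ suc))

∑-++ : ∀ a {b} (f : Fin (a + b) → ℕ) → ∑ f ≡ ∑[ i < a ] f (i ↑ˡ b) + ∑[ j < b ] f (a ↑ʳ j)
∑-++ zero    f = refl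
∑-++ (suc a) f = trans (cong (f zero +_) (∑-++ a (f ∘ suc))) (sym (+-assoc (f zero) _ _))

∑-zero : ∀ {n} {f : Fin n → ℕ} → (∀ i → f i ≡ 0) → ∑ f ≡ 0
∑-zero {n} f≡0 = trans (sum-cong-≗ f≡0) (sum-replicate-zero n)

∑-sift : ∀ {n} (p : Fin n → Bool) x → ∑[ y < n ] 𝟙 (p y ∧ ⌊ x ≟ᶠ y ⌋) ≡ 𝟙 (p x)
∑-sift p zero = trans (cong₂ _+_ (cong 𝟙 (∧-identityʳ (p zero))) (∑-zero λ y → cong 𝟙 (∧-zeroʳ (p (suc y)))))
                      (+-identityʳ _)
∑-sift {suc n} p (suc x) = begin
  𝟙 (p zero ∧ false) + ∑[ y < n ] 𝟙 (p (suc y) ∧ ⌊ suc x ≟ᶠ suc y ⌋)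
    ≡⟨ cong₂ _+_ (cong 𝟙 (∧-zeroʳ (p zero))) (sum-cong-≗ λ y → cong (𝟙 ∘ (p (suc y) ∧_)) (⌊⌋-map′ _ _ (x ≟ᶠ y))) ⟩
  ∑[ y < n ] 𝟙 (p (suc y) ∧ ⌊ x ≟ᶠ y ⌋)
    ≡⟨ ∑-sift (p ∘ suc) x ⟩
  𝟙 (p (suc x)) ∎
  where open ≡-Reasoning

⌊∈?⌋≡lookup : ∀ {m} (S : Subset m) x → ⌊ x ∈? S ⌋ ≡ lookup S x
⌊∈?⌋≡lookup (inside  ∷ S) zero    = refl
⌊∈?⌋≡lookup (outside ∷ S) zero    = refl
⌊∈?⌋≡lookup (_       ∷ S) (suc x) = trans (⌊⌋-map′ _ _ (x ∈? S)) (⌊∈?⌋≡lookup S x)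

∣S∣≡∑ : ∀ {m} (S : Subset m) → ∣ S ∣ ≡ ∑[ x < m ] 𝟙 (lookup S x)
∣S∣≡∑ []            = refl
∣S∣≡∑ (inside  ∷ S) = cong suc (∣S∣≡∑ S)
∣S∣≡∑ (outside ∷ S) = ∣S∣≡∑ S

∣S++T∣ : ∀ {a b} (S : Subset a) (T : Subset b) → ∣ S ++ T ∣ ≡ ∣ S ∣ + ∣ T ∣
∣S++T∣ []            T = refl
∣S++T∣ (inside  ∷ S) T = cong suc (∣S++T∣ S T)
∣S++T∣ (outside ∷ S) T = ∣S++T∣ S T

sum-concatMap : ∀ {A : Set} (f : A → List ℕ) xs → sum (concatMap f xs) ≡ sum (map (sum ∘ f) xs)
sum-concatMap f []       = refl
sum-concatMap f (x ∷ xs) = trans (sum-++ (f x) (concatMap f xs)) (cong (sum (f x) +_) (sum-concatMap f xs))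

sum-map-allFin : ∀ {n} (f : Fin n → ℕ) → sum (map f (allFin n)) ≡ ∑ f
sum-map-allFin {n} f = trans (cong sum (map-tabulate (λ x → x) f)) (sum-tabulate f)
  where
  sum-tabulate : ∀ {n} (f : Fin n → ℕ) → sum (tabulate f) ≡ ∑ f
  sum-tabulate {zero}  f = refl
  sum-tabulate {suc n} f = cong (f zero +_) (sum-tabulate (f ∘ suc))

isInducedEdge : ∀ {m} → Graph m → Subset m → Fin m → Fin m → Bool
isInducedEdge G S x y = (toℕ x <ᵇ toℕ y) ∧ lookup S x ∧ lookup S y ∧ adj G x y

inducedEdges≡∑ : ∀ {m} (G : Graph m) S → inducedEdges G S ≡ ∑[ x < m ] ∑[ y < m ] 𝟙 (isInducedEdge G S x y)
inducedEdges≡∑ {m} G S = begin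
  inducedEdges G S
    ≡⟨ sum-concatMap _ (allFin m) ⟩
  sum (map (λ x → sum (map (λ y → 𝟙 (edge x y)) (allFin m))) (allFin m))
    ≡⟨ cong sum (map-cong (λ x → sum-map-allFin (λ y → 𝟙 (edge x y))) (allFin m)) ⟩
  sum (map (λ x → ∑[ y < m ] 𝟙 (edge x y)) (allFin m))
    ≡⟨ sum-map-allFin (λ x → ∑[ y < m ] 𝟙 (edge x y)) ⟩
  ∑[ x < m ] ∑[ y < m ] 𝟙 (edge x y)
    ≡⟨ sum-cong-≗ (λ x → sum-cong-≗ λ y →
         cong₂ (λ a b → 𝟙 ((toℕ x <ᵇ toℕ y) ∧ a ∧ b ∧ adj G x y)) (⌊∈?⌋≡lookup S x) (⌊∈?⌋≡lookup S y)) ⟩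
  ∑[ x < m ] ∑[ y < m ] 𝟙 (isInducedEdge G S x y) ∎
  where
  open ≡-Reasoning
  edge : Fin m → Fin m → Bool
  edge x y = (toℕ x <ᵇ toℕ y) ∧ ⌊ x ∈? S ⌋ ∧ ⌊ y ∈? S ⌋ ∧ adj G x y

∑∑-++ : ∀ a b (f : Fin (a + b) → Fin (a + b) → ℕ) →
        ∑[ x < a + b ] ∑[ y < a + b ] f x y ≡
          (∑[ i < a ] ∑[ j < a ] f (i ↑ˡ b) (j ↑ˡ b) + ∑[ i < a ] ∑[ j < b ] f (i ↑ˡ b) (a ↑ʳ j))
        + (∑[ i < b ] ∑[ j < a ] f (a ↑ʳ i) (j ↑ˡ b) + ∑[ i < b ] ∑[ j < b ] f (a ↑ʳ i) (a ↑ʳ j))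
∑∑-++ a b f = begin
  ∑[ x < a + b ] ∑[ y < a + b ] f x y
    ≡⟨ ∑-++ a (λ x → ∑[ y < a + b ] f x y) ⟩
  ∑[ i < a ] ∑[ y < a + b ] f (i ↑ˡ b) y + ∑[ i < b ] ∑[ y < a + b ] f (a ↑ʳ i) y
    ≡⟨ cong₂ _+_ (sum-cong-≗ λ i → ∑-++ a (f (i ↑ˡ b))) (sum-cong-≗ λ i → ∑-++ a (f (a ↑ʳ i))) ⟩
  ∑[ i < a ] (ll i + lr i) + ∑[ i < b ] (rl i + rr i)
    ≡⟨ cong₂ _+_ (∑-distrib-+ ll lr) (∑-distrib-+ rl rr) ⟩
  (∑ ll + ∑ lr) + (∑ rl + ∑ rr) ∎
  where
  open ≡-Reasoning
  ll lr : Fin a → ℕ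
  ll i = ∑[ j < a ] f (i ↑ˡ b) (j ↑ˡ b)
  lr i = ∑[ j < b ] f (i ↑ˡ b) (a ↑ʳ j)
  rl rr : Fin b → ℕ
  rl i = ∑[ j < a ] f (a ↑ʳ i) (j ↑ˡ b)
  rr i = ∑[ j < b ] f (a ↑ʳ i) (a ↑ʳ j)

-- Induced edges of G ⊕ G*

<⇒<ᵇ≡true : ∀ {m n} → m < n → (m <ᵇ n) ≡ true
<⇒<ᵇ≡true {zero}  (s≤s _)   = refl
<⇒<ᵇ≡true {suc m} (s≤s m<n) = <⇒<ᵇ≡true m<n

≥⇒<ᵇ≡false : ∀ {m n} → n ≤ m → (m <ᵇ n) ≡ false
≥⇒<ᵇ≡false z≤n       = refl
≥⇒<ᵇ≡false (s≤s n≤m) = ≥⇒<ᵇ≡false n≤m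

+-<ᵇ-cancelˡ : ∀ k m n → (k + m <ᵇ k + n) ≡ (m <ᵇ n)
+-<ᵇ-cancelˡ zero    m n = refl
+-<ᵇ-cancelˡ (suc k) m n = +-<ᵇ-cancelˡ k m n

toℕ-↑ˡ<toℕ-↑ʳ : ∀ {m n} (i : Fin m) (j : Fin n) → toℕ (i ↑ˡ n) < toℕ (m ↑ʳ j)
toℕ-↑ˡ<toℕ-↑ʳ {m} {n} i j =
  subst₂ _<_ (sym (toℕ-↑ˡ i n)) (sym (toℕ-↑ʳ m j)) (≤-trans (toℕ<n i) (m≤m+n m (toℕ j)))

matched : ∀ {k} → Permutation′ k → Subset k → Subset k → ℕ
matched {k} π S T = ∑[ a < k ] 𝟙 (lookup S a ∧ lookup T (π ⟨$⟩ʳ a))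

module _ {k} (G H : Graph k) (π : Permutation′ k) (S T : Subset k) where

  private
    F : Graph (k + k)
    F = ⊕ G H π

  adj-⊕ˡˡ : ∀ a b → adj F (a ↑ˡ k) (b ↑ˡ k) ≡ adj G a b
  adj-⊕ˡˡ a b rewrite splitAt-↑ˡ k a k | splitAt-↑ˡ k b k = refl

  adj-⊕ˡʳ : ∀ a b → adj F (a ↑ˡ k) (k ↑ʳ b) ≡ ⌊ (π ⟨$⟩ʳ a) ≟ᶠ b ⌋
  adj-⊕ˡʳ a b rewrite splitAt-↑ˡ k a k | splitAt-↑ʳ k k b = refl

  adj-⊕ʳʳ : ∀ a b → adj F (k ↑ʳ a) (k ↑ʳ b) ≡ adj H a b
  adj-⊕ʳʳ a b rewrite splitAt-↑ʳ k k a | splitAt-↑ʳ k k b = refl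

  isInducedEdge-⊕ˡˡ : ∀ a b → isInducedEdge F (S ++ T) (a ↑ˡ k) (b ↑ˡ k) ≡ isInducedEdge G S a b
  isInducedEdge-⊕ˡˡ a b =
    cong₂ _∧_ (cong₂ _<ᵇ_ (toℕ-↑ˡ a k) (toℕ-↑ˡ b k))
      (cong₂ _∧_ (lookup-++ˡ S T a) (cong₂ _∧_ (lookup-++ˡ S T b) (adj-⊕ˡˡ a b)))

  isInducedEdge-⊕ˡʳ : ∀ a b → isInducedEdge F (S ++ T) (a ↑ˡ k) (k ↑ʳ b) ≡
                              (lookup S a ∧ lookup T b) ∧ ⌊ (π ⟨$⟩ʳ a) ≟ᶠ b ⌋
  isInducedEdge-⊕ˡʳ a b =
    trans (cong₂ _∧_ (<⇒<ᵇ≡true (toℕ-↑ˡ<toℕ-↑ʳ a b))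
            (cong₂ _∧_ (lookup-++ˡ S T a) (cong₂ _∧_ (lookup-++ʳ S T b) (adj-⊕ˡʳ a b))))
          (sym (∧-assoc (lookup S a) (lookup T b) _))

  isInducedEdge-⊕ʳˡ : ∀ a b → isInducedEdge F (S ++ T) (k ↑ʳ a) (b ↑ˡ k) ≡ false
  isInducedEdge-⊕ʳˡ a b rewrite ≥⇒<ᵇ≡false (<⇒≤ (toℕ-↑ˡ<toℕ-↑ʳ b a)) = refl

  isInducedEdge-⊕ʳʳ : ∀ a b → isInducedEdge F (S ++ T) (k ↑ʳ a) (k ↑ʳ b) ≡ isInducedEdge H T a b
  isInducedEdge-⊕ʳʳ a b =
    cong₂ _∧_ (trans (cong₂ _<ᵇ_ (toℕ-↑ʳ k a) (toℕ-↑ʳ k b)) (+-<ᵇ-cancelˡ k (toℕ a) (toℕ b)))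
      (cong₂ _∧_ (lookup-++ʳ S T a) (cong₂ _∧_ (lookup-++ʳ S T b) (adj-⊕ʳʳ a b)))

  inducedEdges-⊕ : inducedEdges F (S ++ T) ≡ inducedEdges G S + matched π S T + inducedEdges H T
  inducedEdges-⊕ =
    trans (inducedEdges≡∑ F (S ++ T))
      (trans (∑∑-++ k k (λ x y → 𝟙 (isInducedEdge F (S ++ T) x y)))
             (cong₂ _+_ (cong₂ _+_ inside-G between) (cong₂ _+_ backwards inside-H)))
    where
    inside-G : ∑[ a < k ] ∑[ b < k ] 𝟙 (isInducedEdge F (S ++ T) (a ↑ˡ k) (b ↑ˡ k)) ≡ inducedEdges G S
    inside-G = trans (sum-cong-≗ λ a → sum-cong-≗ λ b → cong 𝟙 (isInducedEdge-⊕ˡˡ a b)) (sym (inducedEdges≡∑ G S))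

    between : ∑[ a < k ] ∑[ b < k ] 𝟙 (isInducedEdge F (S ++ T) (a ↑ˡ k) (k ↑ʳ b)) ≡ matched π S T
    between = sum-cong-≗ λ a → trans (sum-cong-≗ λ b → cong 𝟙 (isInducedEdge-⊕ˡʳ a b))
                                     (∑-sift (λ b → lookup S a ∧ lookup T b) (π ⟨$⟩ʳ a))

    backwards : ∑[ a < k ] ∑[ b < k ] 𝟙 (isInducedEdge F (S ++ T) (k ↑ʳ a) (b ↑ˡ k)) ≡ 0
    backwards = ∑-zero λ a → ∑-zero λ b → cong 𝟙 (isInducedEdge-⊕ʳˡ a b)

    inside-H : ∑[ a < k ] ∑[ b < k ] 𝟙 (isInducedEdge F (S ++ T) (k ↑ʳ a) (k ↑ʳ b)) ≡ inducedEdges H T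
    inside-H = trans (sum-cong-≗ λ a → sum-cong-≗ λ b → cong 𝟙 (isInducedEdge-⊕ʳʳ a b)) (sym (inducedEdges≡∑ H T))

𝟙-∧-≤ˡ : ∀ b c → 𝟙 (b ∧ c) ≤ 𝟙 b
𝟙-∧-≤ˡ false _     = z≤n
𝟙-∧-≤ˡ true  false = z≤n
𝟙-∧-≤ˡ true  true  = ≤-refl

𝟙-∧-≤ʳ : ∀ b c → 𝟙 (b ∧ c) ≤ 𝟙 c
𝟙-∧-≤ʳ false _ = z≤n
𝟙-∧-≤ʳ true  _ = ≤-refl

module _ {k} (π : Permutation′ k) where

  ∑-lookup-permute : ∀ (T : Subset k) → ∑[ a < k ] 𝟙 (lookup T (π ⟨$⟩ʳ a)) ≡ ∣ T ∣
  ∑-lookup-permute T = sym (trans (∣S∣≡∑ T) (∑-permute (𝟙 ∘ lookup T) π))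

  matched≤∣S∣ : ∀ S T → matched π S T ≤ ∣ S ∣
  matched≤∣S∣ S T = subst (matched π S T ≤_) (sym (∣S∣≡∑ S)) (∑-mono-≤ λ a → 𝟙-∧-≤ˡ (lookup S a) _)

  matched≤∣T∣ : ∀ S T → matched π S T ≤ ∣ T ∣
  matched≤∣T∣ S T = subst (matched π S T ≤_) (∑-lookup-permute T) (∑-mono-≤ λ a → 𝟙-∧-≤ʳ (lookup S a) _)

  matched-⊤ : ∀ T → matched π ⊤ T ≡ ∣ T ∣
  matched-⊤ T = trans (sum-cong-≗ λ a → cong (λ b → 𝟙 (b ∧ lookup T (π ⟨$⟩ʳ a))) (lookup-replicate a inside))
                      (∑-lookup-permute T)

-- Extremal vertex sets of HL-networks

size≡2^ : ∀ n → size n ≡ 2 ^ n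
size≡2^ zero    = refl
size≡2^ (suc n) = trans (cong₂ _+_ (size≡2^ n) (size≡2^ n)) (cong (2 ^ n +_) (sym (+-identityʳ (2 ^ n))))

inducedEdges≤onesBelow : ∀ {n G} → HL n G → ∀ S → inducedEdges G S ≤ onesBelow ∣ S ∣
inducedEdges≤onesBelow hl₀ S = z≤n
inducedEdges≤onesBelow (hl₊ {n} {G} {H} G∈HL H∈HL π) S with splitAt (size n) S
... | S₁ , S₂ , refl = begin
  inducedEdges (⊕ G H π) (S₁ ++ S₂)
    ≡⟨ inducedEdges-⊕ G H π S₁ S₂ ⟩
  inducedEdges G S₁ + matched π S₁ S₂ + inducedEdges H S₂
    ≤⟨ +-mono-≤ (+-mono-≤ (inducedEdges≤onesBelow G∈HL S₁) (⊓-glb (matched≤∣S∣ π S₁ S₂) (matched≤∣T∣ π S₁ S₂)))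
                (inducedEdges≤onesBelow H∈HL S₂) ⟩
  onesBelow a + a ⊓ b + onesBelow b
    ≡⟨ regroup (onesBelow a) (a ⊓ b) (onesBelow b) ⟩
  onesBelow a + onesBelow b + a ⊓ b
    ≤⟨ superadditive a b ⟩
  onesBelow (a + b)
    ≡⟨ cong onesBelow (∣S++T∣ S₁ S₂) ⟨
  onesBelow ∣ S₁ ++ S₂ ∣ ∎
  where
  open ≤-Reasoning
  a = ∣ S₁ ∣
  b = ∣ S₂ ∣
  regroup : ∀ x m y → x + m + y ≡ x + y + m
  regroup = solve-∀

onesBelow-size+ : ∀ n r → r ≤ size n → onesBelow (size n + r) ≡ onesBelow (size n) + onesBelow r + r
onesBelow-size+ n r r≤ rewrite size≡2^ n = onesBelow-2^+ n r r≤

DenseSet : ∀ {m} → Graph m → ℕ → Set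
DenseSet G g = ∃[ S ] ∣ S ∣ ≡ g × onesBelow g ≤ inducedEdges G S

denseSet-⊕ˡ : ∀ {k} {G H : Graph k} (π : Permutation′ k) {g} → DenseSet G g → DenseSet (⊕ G H π) g
denseSet-⊕ˡ {k} {G} {H} π {g} (S , ∣S∣≡g , S-dense) =
  S ++ ⊥ ,
  trans (∣S++T∣ S ⊥) (trans (cong₂ _+_ ∣S∣≡g (∣⊥∣≡0 k)) (+-identityʳ g)) ,
  (begin
    onesBelow g                                            ≤⟨ S-dense ⟩
    inducedEdges G S                                       ≤⟨ m≤m+n _ _ ⟩
    inducedEdges G S + matched π S ⊥                       ≤⟨ m≤m+n _ _ ⟩
    inducedEdges G S + matched π S ⊥ + inducedEdges H ⊥    ≡⟨ inducedEdges-⊕ G H π S ⊥ ⟨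
    inducedEdges (⊕ G H π) (S ++ ⊥)                        ∎)
  where open ≤-Reasoning

denseSet-full : ∀ {m} {G : Graph m} → DenseSet G m → onesBelow m ≤ inducedEdges G ⊤
denseSet-full {G = G} (S , ∣S∣≡m , S-dense) = subst (λ U → _ ≤ inducedEdges G U) (∣p∣≡n⇒p≡⊤ ∣S∣≡m) S-dense

denseSet-⊕ʳ : ∀ {n} {G H : Graph (size n)} (π : Permutation′ (size n)) {r} → r ≤ size n →
              onesBelow (size n) ≤ inducedEdges G ⊤ → DenseSet H r → DenseSet (⊕ G H π) (size n + r)
denseSet-⊕ʳ {n} {G} {H} π {r} r≤size G-dense (T , ∣T∣≡r , T-dense) =
  ⊤ ++ T ,
  trans (∣S++T∣ (⊤ {size n}) T) (cong₂ _+_ (∣⊤∣≡n (size n)) ∣T∣≡r) ,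
  (begin
    onesBelow (size n + r)                                 ≡⟨ onesBelow-size+ n r r≤size ⟩
    onesBelow (size n) + onesBelow r + r                   ≤⟨ +-mono-≤ (+-mono-≤ G-dense T-dense) (≤-reflexive (sym ∣T∣≡r)) ⟩
    inducedEdges G ⊤ + inducedEdges H T + ∣ T ∣            ≡⟨ regroup (inducedEdges G ⊤) (inducedEdges H T) ∣ T ∣ ⟩
    inducedEdges G ⊤ + ∣ T ∣ + inducedEdges H T            ≡⟨ cong (λ m → inducedEdges G ⊤ + m + inducedEdges H T) (matched-⊤ π T) ⟨
    inducedEdges G ⊤ + matched π ⊤ T + inducedEdges H T    ≡⟨ inducedEdges-⊕ G H π ⊤ T ⟨
    inducedEdges (⊕ G H π) (⊤ ++ T)                        ∎)
  where
  open ≤-Reasoning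
  regroup : ∀ x y m → x + y + m ≡ x + m + y
  regroup = solve-∀

denseSet : ∀ {n G} → HL n G → ∀ g → g ≤ size n → DenseSet G g
denseSet hl₀ zero       _ = outside ∷ [] , refl , z≤n
denseSet hl₀ (suc zero) _ = inside ∷ [] , refl , z≤n
denseSet hl₀ (suc (suc _)) (s≤s ())
denseSet (hl₊ {n} {G} {H} G∈HL H∈HL π) g g≤ with ≤-total g (size n)
... | inj₁ g≤size = denseSet-⊕ˡ {H = H} π (denseSet G∈HL g g≤size)
... | inj₂ size≤g with m≤n⇒∃[o]m+o≡n size≤g
...   | r , refl = denseSet-⊕ʳ {n} {G} {H} π r≤size (denseSet-full (denseSet G∈HL (size n) ≤-refl))
                                                 (denseSet H∈HL r r≤size)
  where
  r≤size : r ≤ size n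
  r≤size = +-cancelˡ-≤ (size n) r (size n) g≤

foldr-⊔-≤ : ∀ {c} xs → All (_≤ c) xs → foldr _⊔_ 0 xs ≤ c
foldr-⊔-≤ []       []           = z≤n
foldr-⊔-≤ (_ ∷ xs) (x≤c ∷ xs≤c) = ⊔-lub x≤c (foldr-⊔-≤ xs xs≤c)

∈⇒≤-foldr-⊔ : ∀ {x xs} → x ∈ xs → x ≤ foldr _⊔_ 0 xs
∈⇒≤-foldr-⊔ {xs = x ∷ xs} (here refl) = m≤m⊔n x _
∈⇒≤-foldr-⊔ {xs = y ∷ xs} (there x∈)  = ≤-trans (∈⇒≤-foldr-⊔ x∈) (m≤n⊔m y _)

∈-allSubsets : ∀ {m} (S : Subset m) → S ∈ allSubsets m
∈-allSubsets []                    = here refl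
∈-allSubsets {suc m} (inside ∷ S)  = ∈-++⁺ˡ (∈-map⁺ (inside ∷_) (∈-allSubsets S))
∈-allSubsets {suc m} (outside ∷ S) = ∈-++⁺ʳ (map (inside ∷_) (allSubsets m)) (∈-map⁺ (outside ∷_) (∈-allSubsets S))

maxEdges≡onesBelow : ∀ {n G} → HL n G → ∀ g → g ≤ size n → maxEdges G g ≡ onesBelow g
maxEdges≡onesBelow {n} {G} G∈HL g g≤ = ≤-antisym upper lower
  where
  bounded : ∀ {S} → ∣ S ∣ ≡ g → inducedEdges G S ≤ onesBelow g
  bounded {S} refl = inducedEdges≤onesBelow G∈HL S

  upper : maxEdges G g ≤ onesBelow g
  upper = foldr-⊔-≤ _ (map⁺ (All.map bounded (all-filter (λ S → ∣ S ∣ ≟ g) (allSubsets (size n)))))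

  lower : onesBelow g ≤ maxEdges G g
  lower with denseSet G∈HL g g≤
  ... | S , ∣S∣≡g , S-dense =
    ≤-trans S-dense (∈⇒≤-foldr-⊔ (∈-map⁺ (inducedEdges G) (∈-filter⁺ (λ S → ∣ S ∣ ≟ g) (∈-allSubsets S) ∣S∣≡g)))

lemma2p4 : (n : ℕ) → 1 ≤ n → (G : Graph (size n)) → HL n G →
           (i : ℕ) → 1 ≤ i → i < 2 ^ n →
           (ts : List ℕ) → Linked _>_ ts → i ≡ sum (map (2 ^_) ts) →
           maxEdges G (suc i) ≡ maxEdges G i + length ts
lemma2p4 n _ G G∈HL i _ i<2^n ts ts↓ i≡∑2^ts = begin
  maxEdges G (suc i)
    ≡⟨ maxEdges≡onesBelow G∈HL (suc i) i<size ⟩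
  onesBelow i + popcount i
    ≡⟨ cong₂ _+_ (maxEdges≡onesBelow G∈HL i (<⇒≤ i<size)) (cong popcount (sym i≡∑2^ts)) ⟨
  maxEdges G i + popcount (sum (map (2 ^_) ts))
    ≡⟨ cong (maxEdges G i +_) (popcount-sum-2^ ts↓) ⟩
  maxEdges G i + length ts ∎
  where
  open ≡-Reasoning
  i<size : i < size n
  i<size = subst (i <_) (sym (size≡2^ n)) i<2^n
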